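{- Let $t$ be an odd integer. Suppose there exists a positive integer $b$ with $t \not\equiv \pm 1 \pmod{2^b}$, and let $b$ be the smallest such positive integer. Then for all integers $k \geq 0$ and all integers $m$ with $1 \leq m < 2^{k+1}$, there exist integers $i, j$ with $0 \leq i < j \leq 2^k$ such that $(t^2)^i \equiv (t^2)^j \pmod{2^b m}$. -}

module Defs where

open import Data.Nat using (ℕ)
open import Data.Integer using (ℤ; +_; _-_; -_)
open import Data.Integer.Divisibility using (_∣_)
open import Data.Product using (_×_)
open import Relation.Nullary using (¬_)

_≡_[mod_] : ℤ → ℤ → ℕ → Set
a ≡ b [mod n ] = (+ n) ∣ (a - b)

Odd : ℤ → Set
Odd t = ¬ ((+ 2) ∣ t)

NotPm1 : ℤ → ℕ → Set
NotPm1 t m = ¬ (t ≡ + 1 [mod m ]) × ¬ (t ≡ - (+ 1) [mod m ])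

{-# OPTIONS --safe #-}
module Submission where

-- Minimality of b gives t ≡ ±1 (mod 2^(b-1)), so 2^b divides t² - 1 = (t - 1)(t + 1), and
-- repeated squaring gives 2^(b+a) ∣ (t²)^(2^a) - 1.  Write m = 2^a·(2h + 1); the bound on m
-- forces k = a + K with h < 2^K.  Modulo 2h + 1, identifying each residue with its negative
-- leaves h + 1 classes, so two of the 2^K + 1 powers t^(2^a·r), 0 ≤ r ≤ 2^K, agree up to sign
-- and their squares agree.  For i = 2^a·r < j = 2^a·r′ both 2^(b+a) and 2h + 1 then divide
-- (t²)^i - (t²)^j, hence so does their product 2^b·m.

module IntegerDivisibility where
  import Data.Nat as ℕ
  import Data.Nat.Properties as ℕ
  open import Data.Integer using (+_; -_; _+_; _-_; _*_; _^_; _%ℕ_; _/ℕ_)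
  open import Data.Integer.Properties using (^-distribˡ-+-*; ^-*-assoc)
  open import Data.Integer.DivMod using (a≡a%ℕn+[a/ℕn]*n)
  open import Data.Integer.Divisibility.Signed
  open import Data.Integer.Tactic.RingSolver using (solve-∀)
  open import Data.Product using (_,_)
  open import Data.Sum using (_⊎_; inj₁; inj₂)
  open import Relation.Binary.PropositionalEquality

  ∣m∧∣n⇒∣m*n : ∀ {i j m n} → i ∣ m → j ∣ n → i * j ∣ m * n
  ∣m∧∣n⇒∣m*n {j = j} {m} i∣m j∣n = ∣-trans (*-monoˡ-∣ j i∣m) (*-monoʳ-∣ m j∣n)

  m*m-n*n≡[m-n]*[m+n] : ∀ m n → m * m - n * n ≡ (m - n) * (m + n)
  m*m-n*n≡[m-n]*[m+n] = solve-∀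

  ∣m-n∧∣m+n⇒∣m*m-n*n : ∀ {i j} m n → i ∣ m - n → j ∣ m + n → i * j ∣ m * m - n * n
  ∣m-n∧∣m+n⇒∣m*m-n*n {i} {j} m n i∣m-n j∣m+n =
    subst (i * j ∣_) (sym (m*m-n*n≡[m-n]*[m+n] m n)) (∣m∧∣n⇒∣m*n i∣m-n j∣m+n)

  ∣m-n⊎∣m+n⇒∣m*m-n*n : ∀ {i} m n → i ∣ m - n ⊎ i ∣ m + n → i ∣ m * m - n * n
  ∣m-n⊎∣m+n⇒∣m*m-n*n {i} m n i∣m∓n =
    subst (i ∣_) (sym (m*m-n*n≡[m-n]*[m+n] m n)) (∣factor i∣m∓n)
    where
    ∣factor : i ∣ m - n ⊎ i ∣ m + n → i ∣ (m - n) * (m + n)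
    ∣factor (inj₁ i∣m-n) = ∣m⇒∣m*n (m + n) i∣m-n
    ∣factor (inj₂ i∣m+n) = ∣n⇒∣m*n (m - n) i∣m+n

  ^-distribʳ-* : ∀ m n e → (m * n) ^ e ≡ m ^ e * n ^ e
  ^-distribʳ-* m n ℕ.zero    = refl
  ^-distribʳ-* m n (ℕ.suc e) = begin
    m * n * (m * n) ^ e       ≡⟨ cong (m * n *_) (^-distribʳ-* m n e) ⟩
    m * n * (m ^ e * n ^ e)   ≡⟨ interchange m n (m ^ e) (n ^ e) ⟩
    m * m ^ e * (n * n ^ e)   ∎
    where
    open ≡-Reasoning
    interchange : ∀ a b c d → a * b * (c * d) ≡ a * c * (b * d)
    interchange = solve-∀

  ∣m-1⇒∣m^e-1 : ∀ {i} m e → i ∣ m - + 1 → i ∣ m ^ e - + 1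
  ∣m-1⇒∣m^e-1 m ℕ.zero    _     = divides (+ 0) refl
  ∣m-1⇒∣m^e-1 {i} m (ℕ.suc e) i∣m-1 = subst (i ∣_) (sym (m*n-1≡m*[n-1]+[m-1] m (m ^ e)))
    (∣m∣n⇒∣m+n (∣n⇒∣m*n m (∣m-1⇒∣m^e-1 m e i∣m-1)) i∣m-1)
    where
    m*n-1≡m*[n-1]+[m-1] : ∀ m n → m * n - + 1 ≡ m * (n - + 1) + (m - + 1)
    m*n-1≡m*[n-1]+[m-1] = solve-∀

  ∣m^d-1⇒∣m^[d*r]-m^[d*r′] : ∀ {i} m d {r r′} → r ℕ.≤ r′ →
                            i ∣ m ^ d - + 1 → i ∣ m ^ (d ℕ.* r) - m ^ (d ℕ.* r′)
  ∣m^d-1⇒∣m^[d*r]-m^[d*r′] {i} m d {r} r≤r′ i∣m^d-1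
    with e , refl ← ℕ.m≤n⇒∃[o]m+o≡n r≤r′ =
    subst (λ z → i ∣ x - z) (sym m^[d*[r+e]]≡x*y)
      (subst (i ∣_) (sym (x-x*y≡-[x*[y-1]] x y))
        (∣m⇒∣-m (∣n⇒∣m*n x (∣m-1⇒∣m^e-1 (m ^ d) e i∣m^d-1))))
    where
    open ≡-Reasoning
    x = m ^ (d ℕ.* r)
    y = (m ^ d) ^ e
    m^[d*[r+e]]≡x*y : m ^ (d ℕ.* (r ℕ.+ e)) ≡ x * y
    m^[d*[r+e]]≡x*y = begin
      m ^ (d ℕ.* (r ℕ.+ e))       ≡⟨ cong (m ^_) (ℕ.*-distribˡ-+ d r e) ⟩
      m ^ (d ℕ.* r ℕ.+ d ℕ.* e)   ≡⟨ ^-distribˡ-+-* m (d ℕ.* r) (d ℕ.* e) ⟩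
      x * m ^ (d ℕ.* e)           ≡⟨ cong (x *_) (^-*-assoc m d e) ⟨
      x * y                       ∎
    x-x*y≡-[x*[y-1]] : ∀ x y → x - x * y ≡ - (x * (y - + 1))
    x-x*y≡-[x*[y-1]] = solve-∀

  ∣m-m%ℕd : ∀ m d .{{_ : ℕ.NonZero d}} → + d ∣ m - + (m %ℕ d)
  ∣m-m%ℕd m d = divides (m /ℕ d) (begin
    m - r                  ≡⟨ cong (_- r) (a≡a%ℕn+[a/ℕn]*n m d) ⟩
    r + m /ℕ d * + d - r   ≡⟨ a+b-a≡b r (m /ℕ d * + d) ⟩
    m /ℕ d * + d           ∎)
    where
    open ≡-Reasoning
    r = + (m %ℕ d)
    a+b-a≡b : ∀ a b → a + b - a ≡ b
    a+b-a≡b = solve-∀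

module PowersOfTwo where
  open import Defs using (Odd; NotPm1)
  open import Data.Nat as ℕ using (suc; s≤s; z≤n; _≤_; _<_; _^_)
  import Data.Nat.Properties as ℕ
  import Data.Nat.Divisibility as ℕ
  open import Data.Integer using (+_; _+_; _-_; _*_; _%ℕ_) renaming (_^_ to _^ℤ_)
  import Data.Integer as ℤ
  open import Data.Integer.Properties using (+-identityʳ; pos-*; ^-identityʳ; ^-distribˡ-+-*)
  open import Data.Integer.DivMod using (n%ℕd<d)
  open import Data.Integer.Divisibility.Signed
  open import Data.Integer.Tactic.RingSolver using (solve-∀)
  open import Data.Product using (_,_)
  open import Data.Sum using (_⊎_; inj₁; inj₂)
  open import Data.Empty using (⊥-elim)
  open import Relation.Nullary using (¬_; yes; no)
  open import Relation.Binary.PropositionalEquality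
  open IntegerDivisibility

  odd⇒2∣m-1 : ∀ m → Odd m → + 2 ∣ m - + 1
  odd⇒2∣m-1 m odd with m %ℕ 2 | n%ℕd<d m 2 | ∣m-m%ℕd m 2
  ... | 0           | _            | 2∣m-0 =
    ⊥-elim (odd (∣⇒∣ᵤ (subst (+ 2 ∣_) (+-identityʳ m) 2∣m-0)))
  ... | 1           | _            | 2∣m-1 = 2∣m-1
  ... | suc (suc _) | s≤s (s≤s ()) | _

  2∣m-1⇒2∣m+1 : ∀ m → + 2 ∣ m - + 1 → + 2 ∣ m + + 1
  2∣m-1⇒2∣m+1 m 2∣m-1 = subst (+ 2 ∣_) (m-1+2≡m+1 m) (∣m∣n⇒∣m+n 2∣m-1 ∣-refl)
    where
    m-1+2≡m+1 : ∀ m → m - + 1 + + 2 ≡ m + + 1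
    m-1+2≡m+1 = solve-∀

  ¬NotPm1⇒∣m∓1 : ∀ m {n} → ¬ NotPm1 m n → + n ∣ m - + 1 ⊎ + n ∣ m + + 1
  ¬NotPm1⇒∣m∓1 m {n} ¬m≢±1 with n ℕ.∣? ℤ.∣ m - + 1 ∣ | n ℕ.∣? ℤ.∣ m + + 1 ∣
  ... | yes n∣m-1 | _         = inj₁ (∣ᵤ⇒∣ n∣m-1)
  ... | no _      | yes n∣m+1 = inj₂ (∣ᵤ⇒∣ n∣m+1)
  ... | no n∤m-1  | no n∤m+1  = ⊥-elim (¬m≢±1 (n∤m-1 , n∤m+1))

  ∣m∓1⇒2^[1+c]∣m*m-1 : ∀ m c → + 2 ∣ m - + 1 → + (2 ^ c) ∣ m - + 1 ⊎ + (2 ^ c) ∣ m + + 1 →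
                       + (2 ^ suc c) ∣ m * m - + 1
  ∣m∓1⇒2^[1+c]∣m*m-1 m c 2∣m-1 (inj₁ 2^c∣m-1) = subst (_∣ m * m - + 1) 2^c*2≡2^[1+c]
    (∣m-n∧∣m+n⇒∣m*m-n*n m (+ 1) 2^c∣m-1 (2∣m-1⇒2∣m+1 m 2∣m-1))
    where
    2^c*2≡2^[1+c] : + (2 ^ c) * + 2 ≡ + (2 ^ suc c)
    2^c*2≡2^[1+c] = trans (sym (pos-* (2 ^ c) 2)) (cong +_ (ℕ.*-comm (2 ^ c) 2))
  ∣m∓1⇒2^[1+c]∣m*m-1 m c 2∣m-1 (inj₂ 2^c∣m+1) = subst (_∣ m * m - + 1) (sym (pos-* 2 (2 ^ c)))
    (∣m-n∧∣m+n⇒∣m*m-n*n m (+ 1) 2∣m-1 2^c∣m+1)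

  2^b∣t*t-1 : ∀ t → Odd t → ∀ b → 1 ≤ b → (∀ b′ → 1 ≤ b′ → b′ < b → ¬ NotPm1 t (2 ^ b′)) →
              + (2 ^ b) ∣ t * t - + 1
  2^b∣t*t-1 t odd (suc ℕ.zero)  _ _       =
    ∣m∓1⇒2^[1+c]∣m*m-1 t 0 (odd⇒2∣m-1 t odd) (inj₁ (∣ᵤ⇒∣ (ℕ.1∣ _)))
  2^b∣t*t-1 t odd (suc (suc c)) _ minimal =
    ∣m∓1⇒2^[1+c]∣m*m-1 t (suc c) (odd⇒2∣m-1 t odd)
      (¬NotPm1⇒∣m∓1 t (minimal (suc c) (s≤s z≤n) ℕ.≤-refl))

  2^c∣m-1⇒2^[c+a]∣m^2^a-1 : ∀ m c a → 1 ≤ c → + (2 ^ c) ∣ m - + 1 →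
                            + (2 ^ (c ℕ.+ a)) ∣ m ^ℤ (2 ^ a) - + 1
  2^c∣m-1⇒2^[c+a]∣m^2^a-1 m c ℕ.zero _ 2^c∣m-1 =
    subst₂ (λ k x → + (2 ^ k) ∣ x - + 1) (sym (ℕ.+-identityʳ c)) (sym (^-identityʳ m)) 2^c∣m-1
  2^c∣m-1⇒2^[c+a]∣m^2^a-1 m c@(suc c′) (suc a) c≥1 2^c∣m-1 =
    subst₂ (λ k x → + (2 ^ k) ∣ x - + 1) (sym (ℕ.+-suc c a)) (sym m^2^[1+a]≡y*y)
      (∣m∓1⇒2^[1+c]∣m*m-1 y (c ℕ.+ a) (∣-trans 2∣2^[c+a] 2^[c+a]∣y-1) (inj₁ 2^[c+a]∣y-1))
    where
    y = m ^ℤ (2 ^ a)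
    2^[c+a]∣y-1 : + (2 ^ (c ℕ.+ a)) ∣ y - + 1
    2^[c+a]∣y-1 = 2^c∣m-1⇒2^[c+a]∣m^2^a-1 m c a c≥1 2^c∣m-1
    2∣2^[c+a] : + 2 ∣ + (2 ^ (c ℕ.+ a))
    2∣2^[c+a] = ∣ᵤ⇒∣ (ℕ.m∣m*n (2 ^ (c′ ℕ.+ a)))
    m^2^[1+a]≡y*y : m ^ℤ (2 ^ suc a) ≡ y * y
    m^2^[1+a]≡y*y = trans (cong (λ e → m ^ℤ (2 ^ a ℕ.+ e)) (ℕ.+-identityʳ (2 ^ a)))
                          (^-distribˡ-+-* m (2 ^ a) (2 ^ a))

module SquaresModuloOdd where
  open import Data.Nat as ℕ using (ℕ; suc; s≤s; _≤_; _<_; _∸_; _≤?_)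
  import Data.Nat.Properties as ℕ
  open import Data.Fin using (Fin; toℕ; fromℕ<)
  import Data.Fin.Properties as Fin
  open import Data.Integer using (ℤ; +_; _+_; _-_; _*_; _^_; _%ℕ_)
  open import Data.Integer.Properties using (pos-+)
  open import Data.Integer.DivMod using (n%ℕd<d)
  open import Data.Integer.Divisibility.Signed
  open import Data.Integer.Tactic.RingSolver using (solve-∀)
  open import Data.Product using (_×_; _,_; ∃-syntax)
  open import Data.Sum using (_⊎_; inj₁; inj₂)
  open import Function using (_∘_)
  open import Relation.Nullary using (yes; no)
  open import Relation.Binary.PropositionalEquality
  open IntegerDivisibility

  -- Identifies a residue x modulo 2h + 1 with its negative 2h + 1 - x.
  fold : ℕ → ℕ → ℕ
  fold h x with x ≤? h
  ... | yes _ = x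
  ... | no  _ = suc (h ℕ.+ h) ∸ x

  fold≤ : ∀ h x → fold h x ≤ h
  fold≤ h x with x ≤? h
  ... | yes x≤h = x≤h
  ... | no  x≰h = ℕ.≤-trans (ℕ.∸-monoʳ-≤ (suc (h ℕ.+ h)) (ℕ.≰⇒> x≰h))
                            (ℕ.≤-reflexive (ℕ.m+n∸m≡n (suc h) h))

  fold-≡⇒≡⊎+≡ : ∀ h {x y} → x < suc (h ℕ.+ h) → y < suc (h ℕ.+ h) → fold h x ≡ fold h y →
                x ≡ y ⊎ x ℕ.+ y ≡ suc (h ℕ.+ h)
  fold-≡⇒≡⊎+≡ h {x} {y} x<o y<o eq with x ≤? h | y ≤? h
  ... | yes _ | yes _ = inj₁ eq
  ... | yes _ | no  _ = inj₂ (trans (cong (ℕ._+ y) eq) (ℕ.m∸n+n≡m (ℕ.<⇒≤ y<o)))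
  ... | no  _ | yes _ = inj₂ (trans (ℕ.+-comm x y)
                             (trans (cong (ℕ._+ x) (sym eq)) (ℕ.m∸n+n≡m (ℕ.<⇒≤ x<o))))
  ... | no  _ | no  _ = inj₁ (trans (sym (ℕ.m∸[m∸n]≡n (ℕ.<⇒≤ x<o)))
                             (trans (cong (suc (h ℕ.+ h) ∸_) eq) (ℕ.m∸[m∸n]≡n (ℕ.<⇒≤ y<o))))

  fold-%ℕ-≡⇒∣m*m-n*n : ∀ h m n → let o = suc (h ℕ.+ h) in
                       fold h (m %ℕ o) ≡ fold h (n %ℕ o) → + o ∣ m * m - n * n
  fold-%ℕ-≡⇒∣m*m-n*n h m n eq = ∣m-n⊎∣m+n⇒∣m*m-n*n m n
    (∣m∓n (fold-≡⇒≡⊎+≡ h (n%ℕd<d m o) (n%ℕd<d n o) eq))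
    where
    o = suc (h ℕ.+ h)
    x = m %ℕ o
    y = n %ℕ o
    ∣m∓n : x ≡ y ⊎ x ℕ.+ y ≡ o → + o ∣ m - n ⊎ + o ∣ m + n
    ∣m∓n (inj₁ x≡y) = inj₁ (subst (+ o ∣_) (m-x-[n-x]≡m-n m n (+ x))
      (∣m∣n⇒∣m-n (∣m-m%ℕd m o) (subst (λ z → + o ∣ n - + z) (sym x≡y) (∣m-m%ℕd n o))))
      where
      m-x-[n-x]≡m-n : ∀ m n x → m - x - (n - x) ≡ m - n
      m-x-[n-x]≡m-n = solve-∀
    ∣m∓n (inj₂ x+y≡o) = inj₂ (subst (+ o ∣_) (m-x+[n-y]+[x+y]≡m+n m n (+ x) (+ y))
      (∣m∣n⇒∣m+n (∣m∣n⇒∣m+n (∣m-m%ℕd m o) (∣m-m%ℕd n o))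
                 (subst (+ o ∣_) (trans (cong +_ (sym x+y≡o)) (pos-+ x y)) ∣-refl)))
      where
      m-x+[n-y]+[x+y]≡m+n : ∀ m n x y → m - x + (n - y) + (x + y) ≡ m + n
      m-x+[n-y]+[x+y]≡m+n = solve-∀

  foldedResidue : ∀ h → ℤ → Fin (suc h)
  foldedResidue h m = fromℕ< (s≤s (fold≤ h (m %ℕ suc (h ℕ.+ h))))

  squares-collide : ∀ (u : ℕ → ℤ) {h N} → h < N →
                    ∃[ r ] ∃[ r′ ] (r < r′ × r′ ≤ N × + suc (h ℕ.+ h) ∣ u r * u r - u r′ * u r′)
  squares-collide u {h} h<N
    with r , r′ , r<r′ , same-class ← Fin.pigeonhole (s≤s h<N) (foldedResidue h ∘ u ∘ toℕ) =
    toℕ r , toℕ r′ , r<r′ , ℕ.s≤s⁻¹ (Fin.toℕ<n r′) ,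
    fold-%ℕ-≡⇒∣m*m-n*n h (u (toℕ r)) (u (toℕ r′))
      (trans (sym (Fin.toℕ-fromℕ< _)) (trans (cong toℕ same-class) (Fin.toℕ-fromℕ< _)))

  square-powers-collide : ∀ m d {h N} → h < N →
    ∃[ r ] ∃[ r′ ] (r < r′ × r′ ≤ N × + suc (h ℕ.+ h) ∣ (m * m) ^ (d ℕ.* r) - (m * m) ^ (d ℕ.* r′))
  square-powers-collide m d {h} h<N =
    let r , r′ , r<r′ , r′≤N , o∣ = squares-collide (λ r → m ^ (d ℕ.* r)) h<N in
    r , r′ , r<r′ , r′≤N ,
    subst₂ (λ x y → + suc (h ℕ.+ h) ∣ x - y)
      (sym (^-distribʳ-* m m (d ℕ.* r))) (sym (^-distribʳ-* m m (d ℕ.* r′))) o∣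

open import Defs
open import Data.Nat using (ℕ; _≤_; _<_; _^_; _*_; _+_; zero; suc; s≤s; z≤n; z<s)
open import Data.Integer using (ℤ; +_) renaming (_*_ to _*ℤ_; _^_ to _^ℤ_)
open import Data.Product using (_×_; ∃-syntax; _,_)
import Data.Integer as ℤ
open import Relation.Nullary using (¬_)
open import Data.Nat.Properties
open import Data.Nat.Divisibility using (_∣_; divides; *-monoʳ-∣)
open import Data.Nat.Coprimality using (Coprime; 1-coprimeTo; coprime-+; coprime-divisor)
open import Data.Nat.Induction using (<-rec)
open import Data.Integer.Divisibility.Signed as ℤ using (∣⇒∣ᵤ)
open import Data.Sum using (_⊎_; inj₁; inj₂)
open import Data.Empty using (⊥-elim)
open import Function using (_∘_)
open import Relation.Binary.PropositionalEquality
open IntegerDivisibility using (∣m^d-1⇒∣m^[d*r]-m^[d*r′])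
open PowersOfTwo using (2^b∣t*t-1; 2^c∣m-1⇒2^[c+a]∣m^2^a-1)
open SquaresModuloOdd using (square-powers-collide)

halve : ∀ n → ∃[ q ] (n ≡ q + q ⊎ n ≡ suc (q + q))
halve zero = 0 , inj₁ refl
halve (suc n) with halve n
... | q , inj₁ n≡q+q   = q , inj₂ (cong suc n≡q+q)
... | q , inj₂ n≡1+q+q = suc q , inj₁ (cong suc (trans n≡1+q+q (sym (+-suc q q))))

m≡2^a*[1+2h] : ∀ {m} → 1 ≤ m → ∃[ a ] ∃[ h ] (m ≡ 2 ^ a * suc (h + h))
m≡2^a*[1+2h] {m} = <-rec P decompose m
  where
  P : ℕ → Set
  P m = 1 ≤ m → ∃[ a ] ∃[ h ] (m ≡ 2 ^ a * suc (h + h))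
  decompose : ∀ m → (∀ {k} → k < m → P k) → P m
  decompose m rec 1≤m with halve m
  ... | h , inj₂ m≡1+h+h = 0 , h , trans m≡1+h+h (sym (*-identityˡ _))
  ... | zero , inj₁ refl = ⊥-elim (n≮0 1≤m)
  ... | q@(suc _) , inj₁ refl with a , h , q≡2^a*o ← rec (m<m+n q z<s) (s≤s z≤n) =
    suc a , h , (begin
      q + q           ≡⟨ cong₂ _+_ q≡2^a*o q≡2^a*o ⟩
      x + x           ≡⟨ cong (λ y → x + y) (+-identityʳ x) ⟨
      2 * x           ≡⟨ *-assoc 2 (2 ^ a) _ ⟨
      2 ^ suc a * _   ∎)
    where
    open ≡-Reasoning
    x = 2 ^ a * suc (h + h)

1+2h-coprimeTo-2 : ∀ h → Coprime (suc (h + h)) 2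
1+2h-coprimeTo-2 zero    = 1-coprimeTo 2
1+2h-coprimeTo-2 (suc h) = subst (λ n → Coprime n 2) (cong (suc ∘ suc) (sym (+-suc h h)))
  (coprime-+ (1+2h-coprimeTo-2 h))

1+2h∣2^c*n⇒1+2h∣n : ∀ h c {n} → suc (h + h) ∣ 2 ^ c * n → suc (h + h) ∣ n
1+2h∣2^c*n⇒1+2h∣n h zero    {n} o∣2^c*n = subst (suc (h + h) ∣_) (*-identityˡ n) o∣2^c*n
1+2h∣2^c*n⇒1+2h∣n h (suc c) {n} o∣2^c*n = 1+2h∣2^c*n⇒1+2h∣n h c
  (coprime-divisor (1+2h-coprimeTo-2 h) (subst (suc (h + h) ∣_) (*-assoc 2 (2 ^ c) n) o∣2^c*n))

2^c∣n∧1+2h∣n⇒2^c*[1+2h]∣n : ∀ c h {n} → 2 ^ c ∣ n → suc (h + h) ∣ n → 2 ^ c * suc (h + h) ∣ n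
2^c∣n∧1+2h∣n⇒2^c*[1+2h]∣n c h (divides q refl) o∣q*2^c =
  subst (2 ^ c * suc (h + h) ∣_) (*-comm (2 ^ c) q)
    (*-monoʳ-∣ (2 ^ c) (1+2h∣2^c*n⇒1+2h∣n h c (subst (suc (h + h) ∣_) (*-comm q (2 ^ c)) o∣q*2^c)))

1+2h<2*n⇒h<n : ∀ {h n} → suc (h + h) < 2 * n → h < n
1+2h<2*n⇒h<n {h} {n} 1+2h<2n = *-cancelˡ-< 2 h n (begin-strict
  2 * h         ≡⟨ cong (λ y → h + y) (+-identityʳ h) ⟩
  h + h         <⟨ n<1+n (h + h) ⟩
  suc (h + h)   <⟨ 1+2h<2n ⟩
  2 * n         ∎)
  where open ≤-Reasoning

2^[1+a]*n<2*m⇒2^a*n<m : ∀ a {n m} → 2 ^ suc a * n < 2 * m → 2 ^ a * n < m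
2^[1+a]*n<2*m⇒2^a*n<m a {n} {m} = *-cancelˡ-< 2 _ m ∘ subst (_< 2 * m) (*-assoc 2 (2 ^ a) n)

2^a*[1+2h]<2^[1+k]⇒k≡a+K∧h<2^K : ∀ a h k → 2 ^ a * suc (h + h) < 2 ^ suc k →
                                 ∃[ K ] (k ≡ a + K × h < 2 ^ K)
2^a*[1+2h]<2^[1+k]⇒k≡a+K∧h<2^K zero h k m<2^[1+k] =
  k , refl , 1+2h<2*n⇒h<n (subst (_< 2 ^ suc k) (*-identityˡ _) m<2^[1+k])
2^a*[1+2h]<2^[1+k]⇒k≡a+K∧h<2^K (suc a) h zero m<2 =
  ⊥-elim (<⇒≱ (2^[1+a]*n<2*m⇒2^a*n<m a m<2) (*-mono-≤ (m^n>0 2 a) (s≤s z≤n)))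
2^a*[1+2h]<2^[1+k]⇒k≡a+K∧h<2^K (suc a) h (suc k) m<2^[2+k]
  with K , refl , h<2^K ← 2^a*[1+2h]<2^[1+k]⇒k≡a+K∧h<2^K a h k (2^[1+a]*n<2*m⇒2^a*n<m a m<2^[2+k]) =
  K , refl , h<2^K

2^[b+a]∣∧1+2h∣⇒≡[mod2^b*[2^a*[1+2h]]] : ∀ b a h x y → + (2 ^ (b + a)) ℤ.∣ x ℤ.- y →
                                         + suc (h + h) ℤ.∣ x ℤ.- y →
                                         x ≡ y [mod 2 ^ b * (2 ^ a * suc (h + h)) ]
2^[b+a]∣∧1+2h∣⇒≡[mod2^b*[2^a*[1+2h]]] b a h x y 2^[b+a]∣x-y 1+2h∣x-y =
  subst (_∣ ℤ.∣ x ℤ.- y ∣)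
    (trans (cong (_* suc (h + h)) (^-distribˡ-+-* 2 b a)) (*-assoc (2 ^ b) (2 ^ a) _))
    (2^c∣n∧1+2h∣n⇒2^c*[1+2h]∣n (b + a) h (∣⇒∣ᵤ 2^[b+a]∣x-y) (∣⇒∣ᵤ 1+2h∣x-y))

lemma6 : (t : ℤ) → Odd t → (b : ℕ) → 1 ≤ b → NotPm1 t (2 ^ b)
    → ((b′ : ℕ) → 1 ≤ b′ → b′ < b → ¬ NotPm1 t (2 ^ b′))
    → (k m : ℕ) → 1 ≤ m → m < 2 ^ (k + 1)
    → ∃[ i ] ∃[ j ] (i < j × j ≤ 2 ^ k × ((t *ℤ t) ^ℤ i) ≡ ((t *ℤ t) ^ℤ j) [mod (2 ^ b) * m ])
lemma6 t odd b b≥1 _ minimal k m m≥1 m<2^[k+1]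
  with a , h , refl ← m≡2^a*[1+2h] m≥1
  with K , refl , h<2^K ← 2^a*[1+2h]<2^[1+k]⇒k≡a+K∧h<2^K a h k
                            (subst (λ e → m < 2 ^ e) (+-comm k 1) m<2^[k+1]) =
  let r , r′ , r<r′ , r′≤2^K , 1+2h∣D = square-powers-collide t (2 ^ a) h<2^K
      2^[b+a]∣D = ∣m^d-1⇒∣m^[d*r]-m^[d*r′] (t *ℤ t) (2 ^ a) (<⇒≤ r<r′)
                    (2^c∣m-1⇒2^[c+a]∣m^2^a-1 (t *ℤ t) b a b≥1 (2^b∣t*t-1 t odd b b≥1 minimal))
  in 2 ^ a * r , 2 ^ a * r′ , *-monoʳ-< (2 ^ a) {{m^n≢0 2 a}} r<r′ ,
     ≤-trans (*-monoʳ-≤ (2 ^ a) r′≤2^K) (≤-reflexive (sym (^-distribˡ-+-* 2 a K))) ,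
     2^[b+a]∣∧1+2h∣⇒≡[mod2^b*[2^a*[1+2h]]] b a h
       ((t *ℤ t) ^ℤ (2 ^ a * r)) ((t *ℤ t) ^ℤ (2 ^ a * r′)) 2^[b+a]∣D 1+2h∣D
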